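{- Let $\mathbb{L}$ be a layer system and let $\mathcal{R}$ be a TRS that is weakly layered according to $\mathbb{L}$. Then $\mathbb{L}$ is closed under rewriting by $\mathcal{R}$: if $L\in\mathbb{L}$ and $L\to_{\mathcal{R}}N$ then $N\in\mathbb{L}$.
   Context: Let $\mathcal{F}$ be a signature and $\mathcal{V}$ a countably infinite set of variables. $\square\notin\mathcal{F}\cup\mathcal{V}$ is a fresh constant (the hole). Contexts are the elements of $\mathcal{C}(\mathcal{F},\mathcal{V})=\mathcal{T}(\mathcal{F}\cup\{\square\},\mathcal{V})$. $\sqsubseteq$ is the smallest reflexive, transitive, monotone relation on contexts with $\square\sqsubseteq C$ for all $C$. $C\sqcup D$ is the least upper bound, when it exists. $\mathrm{Pos}_{\mathcal{F}}(C)$ is the set of positions of $C$ carrying a symbol of $\mathcal{F}$. Rules $\ell\to r$ satisfy $\ell\notin\mathcal{V}$ and $\mathrm{Var}(r)\subseteq\mathrm{Var}(\ell)$. Rewriting is extended to contexts by treating $\square$ as a constant. $s\to_{p,\ell\to r}t$ denotes a step at position $p$ with rule $\ell\to r$. Given $\mathbb{L}\subseteq\mathcal{C}(\mathcal{F},\mathcal{V})$, a top of $C$ is an $L\in\mathbb{L}$ with $L\sqsubseteq C$. A max-top is a $\sqsubseteq$-maximal top. $\mathbb{L}$ is a layer system if: (L1) every term in $\mathcal{T}(\mathcal{F},\mathcal{V})$ has a top other than $\square$; (L2) for $x\in\mathcal{V}$: $C[x]_p\in\mathbb{L}$ iff $C[\square]_p\in\mathbb{L}$; (L3) if $L,N\in\mathbb{L}$,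 $p\in\mathrm{Pos}_{\mathcal{F}}(L)$ and $L|_p\sqcup N$ is defined, then $L[L|_p\sqcup N]_p\in\mathbb{L}$. $\mathcal{R}$ is weakly layered according to $\mathbb{L}$ if for every rule $\ell\to r\in\mathcal{R}$: (W) whenever $M$ is a max-top of a term $s$, $p\in\mathrm{Pos}_{\mathcal{F}}(M)$ and $s\to_{p,\ell\to r}t$, then $M\to_{p,\ell\to r}L$ for some $L\in\mathbb{L}$. -}

module Defs where

open import Data.Nat using (ℕ)
open import Data.Fin using (Fin; toℕ)
open import Data.Vec using (Vec; []; _∷_; lookup; _[_]≔_)
open import Data.List using (List; []; _∷_)
open import Data.Product using (Σ; ∃; _×_; _,_)
open import Relation.Binary.PropositionalEquality using (_≡_; _≢_)
open import Relation.Nullary using (¬_)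
open import Function.Bundles using (_⇔_)

record Signature : Set₁ where
  field
    Fun : Set
    ar  : Fun → ℕ

Var : Set
Var = ℕ

-- Positions: sequences of argument indices (0-based).
Pos : Set
Pos = List ℕ

module _ (S : Signature) where
  open Signature S

  -- Contexts C(F,V) = T(F ∪ {□}, V)
  data Ctx : Set where
    var  : Var → Ctx
    hole : Ctx
    fun  : (f : Fun) → Vec Ctx (ar f) → Ctx

  mutual
    data IsTerm : Ctx → Set where
      var : ∀ x → IsTerm (var x)
      fun : ∀ f {ts} → AllTerm ts → IsTerm (fun f ts)

    data AllTerm : ∀ {n} → Vec Ctx n → Set where
      []  : AllTerm []
      _∷_ : ∀ {n t} {ts : Vec Ctx n} → IsTerm t → AllTerm ts → AllTerm (t ∷ ts)

  mutual
    data Occurs (x : Var) : Ctx → Set where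
      here  : Occurs x (var x)
      there : ∀ f {ts} → OccursIn x ts → Occurs x (fun f ts)

    data OccursIn (x : Var) : ∀ {n} → Vec Ctx n → Set where
      hd : ∀ {n t} {ts : Vec Ctx n} → Occurs x t → OccursIn x (t ∷ ts)
      tl : ∀ {n t} {ts : Vec Ctx n} → OccursIn x ts → OccursIn x (t ∷ ts)

  mutual
    _·_ : (Var → Ctx) → Ctx → Ctx
    σ · var x    = σ x
    σ · hole     = hole
    σ · fun f ts = fun f (σ ·* ts)

    _·*_ : ∀ {n} → (Var → Ctx) → Vec Ctx n → Vec Ctx n
    σ ·* []       = []
    σ ·* (t ∷ ts) = (σ · t) ∷ (σ ·* ts)

  -- C at p ≔ D   means   p ∈ Pos(C) and C|_p = D
  data _at_≔_ : Ctx → Pos → Ctx → Set where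
    here  : ∀ {C} → C at [] ≔ C
    there : ∀ {f ts p D} (i : Fin (ar f)) →
            lookup ts i at p ≔ D → fun f ts at (toℕ i ∷ p) ≔ D

  -- Replace C p D E   means   p ∈ Pos(C) and C[D]_p = E
  data Replace : Ctx → Pos → Ctx → Ctx → Set where
    here  : ∀ {C D} → Replace C [] D D
    there : ∀ {f ts p D u} (i : Fin (ar f)) →
            Replace (lookup ts i) p D u →
            Replace (fun f ts) (toℕ i ∷ p) D (fun f (ts [ i ]≔ u))

  PosF : Ctx → Pos → Set
  PosF C p = Σ Fun λ f → Σ (Vec Ctx (ar f)) λ ts → C at p ≔ fun f ts

  data _⊑_ : Ctx → Ctx → Set where
    ⊑-hole  : ∀ {C} → hole ⊑ C
    ⊑-refl  : ∀ {C} → C ⊑ C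
    ⊑-trans : ∀ {C D E} → C ⊑ D → D ⊑ E → C ⊑ E
    ⊑-mono  : ∀ {f} {ts : Vec Ctx (ar f)} {C D} (i : Fin (ar f)) →
              C ⊑ D → fun f (ts [ i ]≔ C) ⊑ fun f (ts [ i ]≔ D)

  IsLub : Ctx → Ctx → Ctx → Set
  IsLub C D E = C ⊑ E × D ⊑ E × (∀ U → C ⊑ U → D ⊑ U → E ⊑ U)

  IsTRS : (Ctx → Ctx → Set) → Set
  IsTRS R = ∀ l r → R l r →
    IsTerm l × IsTerm r × (∀ x → l ≢ var x) × (∀ x → Occurs x r → Occurs x l)

  Step : Ctx → Pos → Ctx → Ctx → Ctx → Set
  Step s p l r t = Σ (Var → Ctx) λ σ → (s at p ≔ (σ · l)) × Replace s p (σ · r) t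

  RStep : (Ctx → Ctx → Set) → Ctx → Ctx → Set
  RStep R s t = Σ Pos λ p → Σ Ctx λ l → Σ Ctx λ r → R l r × Step s p l r t

  module _ (𝕃 : Ctx → Set) where

    IsTop : Ctx → Ctx → Set
    IsTop L C = 𝕃 L × L ⊑ C

    IsMaxTop : Ctx → Ctx → Set
    IsMaxTop M C = IsTop M C × (∀ L → IsTop L C → M ⊑ L → L ≡ M)

    record IsLayerSystem : Set where
      field
        L1 : ∀ t → IsTerm t → Σ Ctx λ L → IsTop L t × L ≢ hole
        L2 : ∀ C p x E E' → Replace C p (var x) E → Replace C p hole E' →
             (𝕃 E ⇔ 𝕃 E')
        L3 : ∀ L N p Lp J E → 𝕃 L → 𝕃 N → PosF L p →
             L at p ≔ Lp → IsLub Lp N J → Replace L p J E → 𝕃 E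

    WeaklyLayered : (Ctx → Ctx → Set) → Set
    WeaklyLayered R = ∀ l r → R l r → ∀ s t M p →
      IsTerm s → IsMaxTop M s → PosF M p → Step s p l r t →
      Σ Ctx λ L → 𝕃 L × Step M p l r L

    ClosedUnderRewriting : (Ctx → Ctx → Set) → Set
    ClosedUnderRewriting R = ∀ L N → 𝕃 L → RStep R L N → 𝕃 N

module Submission where

-- Let L ∈ 𝕃 and L →_{p, ℓ→r} N.  Weak layering only speaks about steps of
-- TERMS, so we first fill every hole of a context with the variable 0;
-- write ⌈C⌉ for the result.
--   * By (L2), turning one occurrence of a variable into a hole (or back)
--     does not change membership in 𝕃.  Since ⌈C⌉ is reached from C by a
--     chain of such swaps, 𝕃 C ⇔ 𝕃 ⌈C⌉.  In particular ⌈L⌉ ∈ 𝕃.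
--   * A term is ⊑-maximal, so a term in 𝕃 is its own max-top.
--   * Filling commutes with substitution into terms, with taking subterms and
--     with replacement, so the step lifts to ⌈L⌉ →_{p, ℓ→r} ⌈N⌉, and p is a
--     function position because ℓ is not a variable.
--   * Hence (W), applied to the max-top ⌈L⌉ of ⌈L⌉, yields L′ ∈ 𝕃 with
--     ⌈L⌉ →_{p, ℓ→r} L′.  Rewriting at a fixed position with a fixed rule is
--     deterministic (Var(r) ⊆ Var(ℓ)), so L′ = ⌈N⌉, and N ∈ 𝕃 by the first
--     point again.  Only the axiom (L2) of layer systems is needed.

open import Defs
open import Data.Fin using (toℕ; zero; suc)
open import Data.Fin.Properties using (toℕ-injective)
open import Data.Vec using (Vec; []; _∷_; lookup; _[_]≔_)
open import Data.Vec.Properties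
  using (lookup∘update; []≔-idempotent)
  renaming (∷-injective to ∷-injective-Vec)
open import Data.List using ([]; _∷_)
open import Data.List.Properties using (∷-injectiveˡ; ∷-injectiveʳ)
open import Data.Product using (Σ; _×_; _,_; proj₁; proj₂)
open import Data.Empty using (⊥-elim)
open import Relation.Binary.PropositionalEquality
  using (_≡_; _≢_; refl; sym; cong; cong₂; subst)
open import Relation.Binary.Construct.Closure.ReflexiveTransitive
  using (ε; _◅_; _◅◅_)
open import Relation.Binary.Construct.Closure.Symmetric using (fwd; bwd)
open import Relation.Binary.Construct.Closure.Equivalence
  using (EqClosure; gmap; symmetric)
open import Function.Bundles using (_⇔_; Equivalence)

module Rewriting (S : Signature) where
  open Signature S

  fun-injective : ∀ {f} {ts us : Vec (Ctx S) (ar f)} → fun f ts ≡ fun f us → ts ≡ us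
  fun-injective refl = refl

  replace-under : ∀ {f} (ws : Vec (Ctx S) (ar f)) i {c p D e} →
    Replace S c p D e →
    Replace S (fun f (ws [ i ]≔ c)) (toℕ i ∷ p) D (fun f (ws [ i ]≔ e))
  replace-under {f} ws i {c} {p} {D} {e} rep =
    subst (λ vs → Replace S (fun f (ws [ i ]≔ c)) (toℕ i ∷ p) D (fun f vs))
          ([]≔-idempotent ws i)
          (there i (subst (λ u → Replace S u p D e) (sym (lookup∘update i ws c)) rep))

  subterm-unique : ∀ {c p p′ d d′} →
    _at_≔_ S c p d → _at_≔_ S c p′ d′ → p ≡ p′ → d ≡ d′
  subterm-unique here here _ = refl
  subterm-unique (there i a) (there j b) eq with toℕ-injective (∷-injectiveˡ eq)
  ... | refl = subterm-unique a b (∷-injectiveʳ eq)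

  replace-unique : ∀ {c p p′ D e e′} →
    Replace S c p D e → Replace S c p′ D e′ → p ≡ p′ → e ≡ e′
  replace-unique here here _ = refl
  replace-unique (there i a) (there j b) eq with toℕ-injective (∷-injectiveˡ eq)
  ... | refl = cong (λ u → fun _ (_ [ i ]≔ u)) (replace-unique a b (∷-injectiveʳ eq))

  subst-agree : ∀ (τ σ : Var → Ctx S) t →
    (∀ x → Occurs S x t → τ x ≡ σ x) → _·_ S τ t ≡ _·_ S σ t
  subst-agree* : ∀ (τ σ : Var → Ctx S) {n} (ts : Vec (Ctx S) n) →
    (∀ x → OccursIn S x ts → τ x ≡ σ x) → _·*_ S τ ts ≡ _·*_ S σ ts
  subst-agree τ σ (var x) agree = agree x here
  subst-agree τ σ hole agree = refl
  subst-agree τ σ (fun f ts) agree =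
    cong (fun f) (subst-agree* τ σ ts (λ x o → agree x (there f o)))
  subst-agree* τ σ [] agree = refl
  subst-agree* τ σ (t ∷ ts) agree =
    cong₂ _∷_ (subst-agree τ σ t (λ x o → agree x (hd o)))
              (subst-agree* τ σ ts (λ x o → agree x (tl o)))

  subst-agree⁻¹ : ∀ (τ σ : Var → Ctx S) t →
    _·_ S τ t ≡ _·_ S σ t → ∀ x → Occurs S x t → τ x ≡ σ x
  subst-agree*⁻¹ : ∀ (τ σ : Var → Ctx S) {n} (ts : Vec (Ctx S) n) →
    _·*_ S τ ts ≡ _·*_ S σ ts → ∀ x → OccursIn S x ts → τ x ≡ σ x
  subst-agree⁻¹ τ σ (var x) eq .x here = eq
  subst-agree⁻¹ τ σ (fun f ts) eq x (there .f o) =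
    subst-agree*⁻¹ τ σ ts (fun-injective eq) x o
  subst-agree*⁻¹ τ σ (t ∷ ts) eq x (hd o) =
    subst-agree⁻¹ τ σ t (proj₁ (∷-injective-Vec eq)) x o
  subst-agree*⁻¹ τ σ (t ∷ ts) eq x (tl o) =
    subst-agree*⁻¹ τ σ ts (proj₂ (∷-injective-Vec eq)) x o

  -- A rewrite step is determined by the source, the position and the rule,
  -- provided Var(r) ⊆ Var(ℓ): the matcher is fixed on Var(ℓ), hence on Var(r).
  step-unique : ∀ {s p l r t t′} → (∀ x → Occurs S x r → Occurs S x l) →
    Step S s p l r t → Step S s p l r t′ → t ≡ t′
  step-unique {s} {p} {l} {r} {t} {t′} vars (σ , at , rep) (τ , at′ , rep′) =
    replace-unique rep (subst (λ u → Replace S s p u t′) (sym same-rhs) rep′) refl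
    where
    same-rhs : _·_ S σ r ≡ _·_ S τ r
    same-rhs = subst-agree σ τ r (λ x o →
      subst-agree⁻¹ σ τ l (subterm-unique at at′ refl) x (vars x o))

  redex-posF : ∀ {s p l r t} → IsTerm S l → (∀ x → l ≢ var x) →
    Step S s p l r t → PosF S s p
  redex-posF (var x) nonvar _ = ⊥-elim (nonvar x refl)
  redex-posF (fun g _) nonvar (_ , at , _) = g , _ , at

  lookup-term : ∀ {n} {ts : Vec (Ctx S) n} → AllTerm S ts → ∀ i → IsTerm S (lookup ts i)
  lookup-term (t ∷ _) zero = t
  lookup-term (_ ∷ ts) (suc i) = lookup-term ts i

  term-maximal : ∀ {t d} → IsTerm S t → _⊑_ S t d → d ≡ t
  term-maximal () ⊑-hole
  term-maximal t ⊑-refl = refl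
  term-maximal t (⊑-trans t⊑c c⊑d) with term-maximal t t⊑c
  ... | refl = term-maximal t c⊑d
  term-maximal (fun f ts) (⊑-mono {ts = ws} {C = c} i c⊑d)
    with term-maximal (subst (IsTerm S) (lookup∘update i ws c) (lookup-term ts i)) c⊑d
  ... | refl = refl

  fill : Ctx S → Ctx S
  fill* : ∀ {n} → Vec (Ctx S) n → Vec (Ctx S) n
  fill (var x) = var x
  fill hole = var 0
  fill (fun f ts) = fun f (fill* ts)
  fill* [] = []
  fill* (t ∷ ts) = fill t ∷ fill* ts

  fill*-lookup : ∀ {n} (ts : Vec (Ctx S) n) i → lookup (fill* ts) i ≡ fill (lookup ts i)
  fill*-lookup (t ∷ ts) zero = refl
  fill*-lookup (t ∷ ts) (suc i) = fill*-lookup ts i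

  fill*-update : ∀ {n} (ts : Vec (Ctx S) n) i u → fill* (ts [ i ]≔ u) ≡ fill* ts [ i ]≔ fill u
  fill*-update (t ∷ ts) zero u = refl
  fill*-update (t ∷ ts) (suc i) u = cong (fill t ∷_) (fill*-update ts i u)

  fill-term : ∀ c → IsTerm S (fill c)
  fill*-term : ∀ {n} (ts : Vec (Ctx S) n) → AllTerm S (fill* ts)
  fill-term (var x) = var x
  fill-term hole = var 0
  fill-term (fun f ts) = fun f (fill*-term ts)
  fill*-term [] = []
  fill*-term (t ∷ ts) = fill-term t ∷ fill*-term ts

  fill-subst : ∀ (σ : Var → Ctx S) {t} → IsTerm S t →
    fill (_·_ S σ t) ≡ _·_ S (λ x → fill (σ x)) t
  fill-subst* : ∀ (σ : Var → Ctx S) {n} {ts : Vec (Ctx S) n} → AllTerm S ts →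
    fill* (_·*_ S σ ts) ≡ _·*_ S (λ x → fill (σ x)) ts
  fill-subst σ (var x) = refl
  fill-subst σ (fun f ts) = cong (fun f) (fill-subst* σ ts)
  fill-subst* σ [] = refl
  fill-subst* σ (t ∷ ts) = cong₂ _∷_ (fill-subst σ t) (fill-subst* σ ts)

  fill-at : ∀ {c p d} → _at_≔_ S c p d → _at_≔_ S (fill c) p (fill d)
  fill-at here = here
  fill-at {fun f ts} (there i a) =
    there i (subst (λ u → _at_≔_ S u _ _) (sym (fill*-lookup ts i)) (fill-at a))

  fill-replace : ∀ {c p D e} → Replace S c p D e → Replace S (fill c) p (fill D) (fill e)
  fill-replace here = here
  fill-replace {fun f ts} (there {u = u} i rep) =
    subst (λ vs → Replace S (fun f (fill* ts)) _ _ (fun f vs)) (sym (fill*-update ts i u))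
      (there i (subst (λ c → Replace S c _ _ _) (sym (fill*-lookup ts i)) (fill-replace rep)))

  fill-step : ∀ {s p l r t} → IsTerm S l → IsTerm S r →
    Step S s p l r t → Step S (fill s) p l r (fill t)
  fill-step {s} {p} {l} {r} {t} l-term r-term (σ , at , rep) =
    (λ x → fill (σ x)) ,
    subst (λ u → _at_≔_ S (fill s) p u) (fill-subst σ l-term) (fill-at at) ,
    subst (λ u → Replace S (fill s) p u (fill t)) (fill-subst σ r-term) (fill-replace rep)

  HoleSwap : Ctx S → Ctx S → Set
  HoleSwap a b = Σ (Ctx S) λ K → Σ Pos λ p → Replace S K p (var 0) a × Replace S K p hole b

  _≈_ : Ctx S → Ctx S → Set
  _≈_ = EqClosure HoleSwap

  SwapCongruent : ∀ {m} → (Vec (Ctx S) m → Ctx S) → Set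
  SwapCongruent {m} F = ∀ (ws : Vec (Ctx S) m) i {c d} →
    HoleSwap c d → HoleSwap (F (ws [ i ]≔ c)) (F (ws [ i ]≔ d))

  fun-swapCongruent : ∀ f → SwapCongruent (fun f)
  fun-swapCongruent f ws i (K , p , K[x] , K[□]) =
    fun f (ws [ i ]≔ K) , toℕ i ∷ p , replace-under ws i K[x] , replace-under ws i K[□]

  -- Every context is swap-equivalent to its filling: fill the holes argument
  -- by argument, each time inside a swap-congruent surrounding.
  fill-≈ : ∀ c → c ≈ fill c
  fill*-≈ : ∀ {m} (F : Vec (Ctx S) m → Ctx S) → SwapCongruent F →
    ∀ ts → F ts ≈ F (fill* ts)
  fill-≈ (var x) = ε
  fill-≈ hole = bwd (hole , [] , here , here) ◅ ε
  fill-≈ (fun f ts) = fill*-≈ (fun f) (fun-swapCongruent f) ts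
  fill*-≈ F congruent [] = ε
  fill*-≈ F congruent (t ∷ ts) =
    gmap (λ c → F (c ∷ ts)) (congruent (t ∷ ts) zero) (fill-≈ t) ◅◅
    fill*-≈ (λ ws → F (fill t ∷ ws)) (λ ws i → congruent (fill t ∷ ws) (suc i)) ts

  module _ (𝕃 : Ctx S → Set)
           (L2 : ∀ C p x E E′ → Replace S C p (var x) E → Replace S C p hole E′ →
                 (𝕃 E ⇔ 𝕃 E′)) where

    ≈-transport : ∀ {a b} → a ≈ b → 𝕃 a → 𝕃 b
    ≈-transport ε a∈𝕃 = a∈𝕃
    ≈-transport (fwd (K , p , K[x] , K[□]) ◅ rest) a∈𝕃 =
      ≈-transport rest (Equivalence.to (L2 K p 0 _ _ K[x] K[□]) a∈𝕃)
    ≈-transport (bwd (K , p , K[x] , K[□]) ◅ rest) a∈𝕃 =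
      ≈-transport rest (Equivalence.from (L2 K p 0 _ _ K[x] K[□]) a∈𝕃)

    fill-𝕃 : ∀ c → 𝕃 c → 𝕃 (fill c)
    fill-𝕃 c = ≈-transport (fill-≈ c)

    unfill-𝕃 : ∀ c → 𝕃 (fill c) → 𝕃 c
    unfill-𝕃 c = ≈-transport (symmetric HoleSwap (fill-≈ c))

    term-maxTop : ∀ {t} → IsTerm S t → 𝕃 t → IsMaxTop S 𝕃 t t
    term-maxTop t t∈𝕃 = (t∈𝕃 , ⊑-refl) , λ _ _ t⊑L → term-maximal t t⊑L

lemma3p10 : (S : Signature) (𝕃 : Ctx S → Set) (R : Ctx S → Ctx S → Set) →
    IsLayerSystem S 𝕃 → IsTRS S R → WeaklyLayered S 𝕃 R →
    ClosedUnderRewriting S 𝕃 R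
lemma3p10 S 𝕃 R layer trs weak L N L∈𝕃 (p , l , r , l→r , step) =
  unfill-𝕃 𝕃 L2 N (subst 𝕃 L′≡⌈N⌉ (proj₁ (proj₂ layered)))
  where
  open Rewriting S
  open IsLayerSystem layer using (L2)
  l-term : IsTerm S l
  l-term = proj₁ (trs l r l→r)
  r-term : IsTerm S r
  r-term = proj₁ (proj₂ (trs l r l→r))
  l-nonvar : ∀ x → l ≢ var x
  l-nonvar = proj₁ (proj₂ (proj₂ (trs l r l→r)))
  r-vars : ∀ x → Occurs S x r → Occurs S x l
  r-vars = proj₂ (proj₂ (proj₂ (trs l r l→r)))

  ⌈step⌉ : Step S (fill L) p l r (fill N)
  ⌈step⌉ = fill-step l-term r-term step

  layered : Σ (Ctx S) λ L′ → 𝕃 L′ × Step S (fill L) p l r L′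
  layered = weak l r l→r (fill L) (fill N) (fill L) p (fill-term L)
              (term-maxTop 𝕃 L2 (fill-term L) (fill-𝕃 𝕃 L2 L L∈𝕃))
              (redex-posF {r = r} l-term l-nonvar ⌈step⌉) ⌈step⌉

  L′≡⌈N⌉ : proj₁ layered ≡ fill N
  L′≡⌈N⌉ = step-unique r-vars (proj₂ (proj₂ layered)) ⌈step⌉
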